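{- If $P$ is a poset with the block decomposition $Q_1<\dots<Q_t$ and $m$ is the number of blocks of $P$ that are chains, then $\operatorname{iir}(P) \leq |P|-m$.
   Context: All posets are finite with non-empty ground sets. An inclusion representation of $P$ is a family $\mathcal{S}=\{S_x:x\in P\}$ with $x\le y$ iff $S_x\subseteq S_y$. $\mathcal{S}$ is a reduction of $\mathcal{S}'$ if $|\bigcup\mathcal{S}|\le|\bigcup\mathcal{S}'|$ and $|S_x|\le|S'_x|$ for all $x$; a strict reduction if additionally $\mathcal{S}'$ is not a reduction of $\mathcal{S}$; irreducible if it has no strict reduction. $\operatorname{iir}(P)$ is the maximum ground-set size of an irreducible inclusion representation of $P$. The vertical sum $Q_1<\dots<Q_t$ has $x\le y$ iff $x,y\in Q_i$ with $x\le y$ in $Q_i$, or $x\in Q_i,y\in Q_j$, $i<j$. A block is a chain or a poset not a vertical sum of two non-empty posets; the block decomposition of a non-block $P$ is $P=Q_1<\dots<Q_t$ with least $t\ge2$ and all $Q_i$ blocks (for a block $P$, it is $P$ itself). -}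

module Defs where

open import Data.Nat using (ℕ; _≤_; _∸_)
open import Data.Fin using (Fin) renaming (_<_ to _<ᶠ_)
open import Data.Fin.Subset using (Subset; _∈_; _⊆_; ⋃; ∣_∣)
open import Data.List using (tabulate)
open import Data.Product using (Σ; ∃; _×_)
open import Data.Sum using (_⊎_)
open import Data.Unit using (⊤)
open import Relation.Nullary using (¬_)
open import Relation.Binary.PropositionalEquality using (_≡_)
open import Relation.Binary.Structures using (IsPartialOrder)
open import Function.Bundles using (_⇔_)

record FinPoset : Set₁ where
  field
    n         : ℕ
    nonEmpty  : 1 ≤ n
    _≼_       : Fin n → Fin n → Set
    isPartialOrder : IsPartialOrder _≡_ _≼_

module _ (P : FinPoset) where
  open FinPoset P

  IsChainOn : (Fin n → Set) → Set
  IsChainOn U = ∀ x y → U x → U y → (x ≼ y) ⊎ (y ≼ x)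

  -- The induced subposet on U is the vertical sum Q_0 < … < Q_{t-1} of the
  -- (non-empty, induced) subposets Q_i = {x ∈ U | p x ≡ i}.
  IsVerticalSumOn : (Fin n → Set) → (t : ℕ) → (Fin n → Fin t) → Set
  IsVerticalSumOn U t p =
    (∀ i → ∃ λ x → U x × p x ≡ i) ×
    (∀ x y → U x → U y →
      (x ≼ y) ⇔ ((p x ≡ p y × x ≼ y) ⊎ (p x <ᶠ p y)))

  IsBlockOn : (Fin n → Set) → Set
  IsBlockOn U = IsChainOn U ⊎ ¬ (Σ (Fin n → Fin 2) λ p → IsVerticalSumOn U 2 p)

  IsBlock : Set
  IsBlock = IsBlockOn (λ _ → ⊤)

  IsDecompIntoBlocks : (t : ℕ) → (Fin n → Fin t) → Set
  IsDecompIntoBlocks t p =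
    IsVerticalSumOn (λ _ → ⊤) t p × (∀ i → IsBlockOn (λ x → p x ≡ i))

  IsBlockDecomposition : (t : ℕ) → (Fin n → Fin t) → Set
  IsBlockDecomposition t p =
    IsDecompIntoBlocks t p ×
    ((IsBlock × t ≡ 1) ⊎
     (¬ IsBlock × 2 ≤ t ×
      (∀ t′ (p′ : Fin n → Fin t′) → 2 ≤ t′ → IsDecompIntoBlocks t′ p′ → t ≤ t′)))

  IsInclRep : (k : ℕ) → (Fin n → Subset k) → Set
  IsInclRep k S = ∀ x y → (x ≼ y) ⇔ (S x ⊆ S y)

  groundSize : {k : ℕ} → (Fin n → Subset k) → ℕ
  groundSize S = ∣ ⋃ (tabulate S) ∣

  IsReduction : {k k′ : ℕ} → (Fin n → Subset k) → (Fin n → Subset k′) → Set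
  IsReduction S S′ = groundSize S ≤ groundSize S′ × (∀ x → ∣ S x ∣ ≤ ∣ S′ x ∣)

  IsStrictReduction : {k k′ : ℕ} → (Fin n → Subset k) → (Fin n → Subset k′) → Set
  IsStrictReduction S S′ = IsReduction S S′ × ¬ IsReduction S′ S

  IsIrreducible : (k : ℕ) → (Fin n → Subset k) → Set
  IsIrreducible k S =
    IsInclRep k S ×
    (∀ k′ (S′ : Fin n → Subset k′) → IsInclRep k′ S′ → ¬ IsStrictReduction S′ S)

  -- "iir(P) ≤ b": every irreducible inclusion representation of P has
  -- ground set of size at most b (iir is the maximum of these sizes).
  iir≤ : ℕ → Set
  iir≤ b = ∀ k (S : Fin n → Subset k) → IsIrreducible k S → groundSize S ≤ b

-- Let J be the set of elements of P that are join-irreducible in its Dedekind–MacNeille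
-- completion.  Given an inclusion representation S with points in Fin k, pick B ⊆ Fin k
-- maximising ∣ B ∣ − ∣ meets B ∣, where meets B is the set of z ∈ J whose set S z meets
-- B, and replace the points of B by one new point for each z ∈ meets B.  Maximality of B
-- makes this a reduction of S with at most ∣ J ∣ points, so an irreducible representation
-- has at most ∣ J ∣ points.  The least element of a chain block is not in J: otherwise the
-- block just below would have a greatest element, hence be a chain as well, and merging
-- the two chain blocks would contradict the minimality of the block decomposition.
{-# OPTIONS --safe #-}
module Submission where

open import Defs
open import Data.Nat using (ℕ; zero; suc; _+_; _∸_; _≤_; _<_; z≤n; s≤s)
import Data.Nat.Properties as ℕ
open import Data.Fin using (Fin; zero; suc; toℕ; fromℕ<; inject₁; pinch; _↑ˡ_; _↑ʳ_)
  renaming (_<_ to _<ᶠ_; _≤_ to _≤ᶠ_)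
import Data.Fin.Properties as Fin
open import Data.Fin.Induction using (po-wellFounded)
open import Data.Fin.Subset
  using (Subset; inside; outside; _∈_; _∉_; _⊆_; _∩_; _∪_; _─_; _-_; ∁; ⋃; ∣_∣; ⁅_⁆)
open import Data.Fin.Subset.Properties
  using ( _∈?_; _⊆?_; nonempty?; drop-∷-⊆; ∉⊥; x∈⁅x⁆; ∣⁅x⁆∣≡1; ⊆-trans; ⊆-antisym
        ; Empty-unique; ∣⊥∣≡0; p⊆q⇒∣p∣≤∣q∣; p⊆q⇒∁p⊇∁q; x∉p⇒x∈∁p; ∣∁p∣≡n∸∣p∣
        ; x∈p∩q⁺; x∈p∩q⁻; p∩q⊆p; p∩q⊆q
        ; ∣p∩q∣≤∣q∣; p⊆p∪q; q⊆p∪q; x∈p∪q⁻; x∈p∧x∉q⇒x∈p─q; p─q⊆p)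
open import Data.Vec using ([]; _∷_; _++_; here; there; tabulate)
open import Data.Vec.Properties using (lookup∘tabulate; lookup⇒[]=; []=⇒lookup)
import Data.List as List
open import Data.Product using (∃; _×_; _,_; proj₁; proj₂)
open import Data.Sum using (_⊎_; inj₁; inj₂)
open import Data.Unit using (⊤; tt)
open import Data.Empty using (⊥; ⊥-elim)
open import Function using (_∘_)
open import Function.Bundles using (_⇔_; mk⇔; Equivalence)
import Function.Properties.Equivalence as ⇔
open import Function.Definitions using (Surjective)
open import Relation.Nullary using (¬_; yes; no; does; ¬?; contradiction)
open import Relation.Nullary.Decidable using (_×-dec_; _→-dec_; map′; dec-true; decidable-stable)
open import Relation.Binary.Definitions using (Decidable; tri<; tri≈; tri>)
import Relation.Binary.Construct.NonStrictToStrict as ToStrict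
open import Relation.Binary.Structures using (IsPartialOrder)
open import Relation.Binary.PropositionalEquality
  using (_≡_; _≢_; refl; sym; trans; cong; subst; module ≡-Reasoning)
import Relation.Unary as U
open import Induction.WellFounded using (Acc; acc)
open import Algebra.Properties.CommutativeSemigroup ℕ.+-commutativeSemigroup using (xy∙z≈xz∙y)

open Equivalence using (to; from)

toSubset : ∀ {m} {Q : Fin m → Set} → U.Decidable Q → Subset m
toSubset Q? = tabulate (λ x → does (Q? x))

∈-toSubset⁺ : ∀ {m} {Q : Fin m → Set} (Q? : U.Decidable Q) {x} → Q x → x ∈ toSubset Q?
∈-toSubset⁺ Q? {x} Qx = lookup⇒[]= x _ (trans (lookup∘tabulate _ x) (dec-true (Q? x) Qx))

∈-toSubset⁻ : ∀ {m} {Q : Fin m → Set} (Q? : U.Decidable Q) {x} → x ∈ toSubset Q? → Q x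
∈-toSubset⁻ Q? {x} x∈
  with Q? x | trans (sym (lookup∘tabulate (λ y → does (Q? y)) x)) ([]=⇒lookup x∈)
... | yes Qx | _  = Qx
... | no _   | ()

x∈p─q⇒x∉q : ∀ {m} {p q : Subset m} {x} → x ∈ p ─ q → x ∉ q
x∈p─q⇒x∉q {p = _ ∷ _} {outside ∷ _} here          ()
x∈p─q⇒x∉q {p = _ ∷ _} {_ ∷ _}       (there x∈p─q) (there x∈q) = x∈p─q⇒x∉q x∈p─q x∈q

─-monoˡ-⊆ : ∀ {m} {p q : Subset m} (r : Subset m) → p ⊆ q → p ─ r ⊆ q ─ r
─-monoˡ-⊆ _ p⊆q x∈p─r = x∈p∧x∉q⇒x∈p─q (p⊆q (p─q⊆p _ _ x∈p─r)) (x∈p─q⇒x∉q x∈p─r)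

p⊈q⇒∃x∈p∖q : ∀ {m} {p q : Subset m} → ¬ p ⊆ q → ∃ λ x → x ∈ p × x ∉ q
p⊈q⇒∃x∈p∖q {p = p} {q} p⊈q with Fin.any? (λ x → (x ∈? p) ×-dec ¬? (x ∈? q))
... | yes witness = witness
... | no none     =
  ⊥-elim (p⊈q λ {x} x∈p → decidable-stable (x ∈? q) (λ x∉q → none (x , x∈p , x∉q)))

∣p∣≡∣p∩q∣+∣p─q∣ : ∀ {m} (p q : Subset m) → ∣ p ∣ ≡ ∣ p ∩ q ∣ + ∣ p ─ q ∣
∣p∣≡∣p∩q∣+∣p─q∣ []            []            = refl
∣p∣≡∣p∩q∣+∣p─q∣ (inside  ∷ p) (inside  ∷ q) = cong suc (∣p∣≡∣p∩q∣+∣p─q∣ p q)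
∣p∣≡∣p∩q∣+∣p─q∣ (inside  ∷ p) (outside ∷ q) =
  trans (cong suc (∣p∣≡∣p∩q∣+∣p─q∣ p q)) (sym (ℕ.+-suc _ _))
∣p∣≡∣p∩q∣+∣p─q∣ (outside ∷ p) (inside  ∷ q) = ∣p∣≡∣p∩q∣+∣p─q∣ p q
∣p∣≡∣p∩q∣+∣p─q∣ (outside ∷ p) (outside ∷ q) = ∣p∣≡∣p∩q∣+∣p─q∣ p q

p⊆q⇒∣q∣≡∣p∣+∣q─p∣ : ∀ {m} {p q : Subset m} → p ⊆ q → ∣ q ∣ ≡ ∣ p ∣ + ∣ q ─ p ∣
p⊆q⇒∣q∣≡∣p∣+∣q─p∣ {p = p} {q} p⊆q =
  trans (∣p∣≡∣p∩q∣+∣p─q∣ q p) (cong (λ r → ∣ r ∣ + ∣ q ─ p ∣) q∩p≡p)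
  where
  q∩p≡p : q ∩ p ≡ p
  q∩p≡p = ⊆-antisym (p∩q⊆q q p) (λ x∈p → x∈p∩q⁺ (p⊆q x∈p , x∈p))

∁p─∁q≡q─p : ∀ {m} (p q : Subset m) → ∁ p ─ ∁ q ≡ q ─ p
∁p─∁q≡q─p []            []            = refl
∁p─∁q≡q─p (inside  ∷ p) (inside  ∷ q) = cong (outside ∷_) (∁p─∁q≡q─p p q)
∁p─∁q≡q─p (inside  ∷ p) (outside ∷ q) = cong (outside ∷_) (∁p─∁q≡q─p p q)
∁p─∁q≡q─p (outside ∷ p) (inside  ∷ q) = cong (inside  ∷_) (∁p─∁q≡q─p p q)
∁p─∁q≡q─p (outside ∷ p) (outside ∷ q) = cong (outside ∷_) (∁p─∁q≡q─p p q)

∣p++q∣≡∣p∣+∣q∣ : ∀ {m l} (p : Subset m) (q : Subset l) → ∣ p ++ q ∣ ≡ ∣ p ∣ + ∣ q ∣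
∣p++q∣≡∣p∣+∣q∣ []            q = refl
∣p++q∣≡∣p∣+∣q∣ (inside  ∷ p) q = cong suc (∣p++q∣≡∣p∣+∣q∣ p q)
∣p++q∣≡∣p∣+∣q∣ (outside ∷ p) q = ∣p++q∣≡∣p∣+∣q∣ p q

++-mono-⊆ : ∀ {m l} {p p′ : Subset m} {q q′ : Subset l} → p ⊆ p′ → q ⊆ q′ → p ++ q ⊆ p′ ++ q′
++-mono-⊆ {p = []}    {[]}     _    q⊆q′ x∈ = q⊆q′ x∈
++-mono-⊆ {p = _ ∷ _} {_ ∷ _} p⊆p′ q⊆q′ here with p⊆p′ here
... | here = here
++-mono-⊆ {p = _ ∷ _} {_ ∷ _} p⊆p′ q⊆q′ (there x∈) = there (++-mono-⊆ (drop-∷-⊆ p⊆p′) q⊆q′ x∈)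

∈-++⁺ˡ : ∀ {m l} {p : Subset m} (q : Subset l) {x} → x ∈ p → x ↑ˡ l ∈ p ++ q
∈-++⁺ˡ q here        = here
∈-++⁺ˡ q (there x∈p) = there (∈-++⁺ˡ q x∈p)

∈-++⁺ʳ : ∀ {m l} (p : Subset m) {q : Subset l} {x} → x ∈ q → m ↑ʳ x ∈ p ++ q
∈-++⁺ʳ []      x∈q = x∈q
∈-++⁺ʳ (_ ∷ p) x∈q = there (∈-++⁺ʳ p x∈q)

∈-++⁻ˡ : ∀ {m l} (p : Subset m) {q : Subset l} {x} → x ↑ˡ l ∈ p ++ q → x ∈ p
∈-++⁻ˡ (_ ∷ p) {x = zero}  here      = here
∈-++⁻ˡ (_ ∷ p) {x = suc x} (there x∈) = there (∈-++⁻ˡ p x∈)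

∈-++⁻ʳ : ∀ {m l} (p : Subset m) {q : Subset l} {x} → m ↑ʳ x ∈ p ++ q → x ∈ q
∈-++⁻ʳ []      x∈         = x∈
∈-++⁻ʳ (_ ∷ p) (there x∈) = ∈-++⁻ʳ p x∈

⊆-⋃-tabulate : ∀ {m l} (F : Fin m → Subset l) i → F i ⊆ ⋃ (List.tabulate F)
⊆-⋃-tabulate F zero    = p⊆p∪q _
⊆-⋃-tabulate F (suc i) = ⊆-trans (⊆-⋃-tabulate (F ∘ suc) i) (q⊆p∪q (F zero) _)

⋃-tabulate-least : ∀ {m l} {F : Fin m → Subset l} {q} → (∀ i → F i ⊆ q) → ⋃ (List.tabulate F) ⊆ q
⋃-tabulate-least {zero}          _   x∈ = contradiction x∈ ∉⊥
⋃-tabulate-least {suc m} {F = F} F⊆q x∈ with x∈p∪q⁻ (F zero) _ x∈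
... | inj₁ x∈F₀   = F⊆q zero x∈F₀
... | inj₂ x∈rest = ⋃-tabulate-least (F⊆q ∘ suc) x∈rest

∃-maximiser : ∀ {m} (f : Subset m → ℕ) → ∃ λ B → ∀ B′ → f B′ ≤ f B
∃-maximiser {zero}  f = [] , λ { [] → ℕ.≤-refl }
∃-maximiser {suc m} f with ∃-maximiser (f ∘ (inside ∷_)) | ∃-maximiser (f ∘ (outside ∷_))
... | I , I-max | O , O-max with ℕ.≤-total (f (inside ∷ I)) (f (outside ∷ O))
... | inj₁ I≤O = outside ∷ O ,
  λ { (inside ∷ B) → ℕ.≤-trans (I-max B) I≤O ; (outside ∷ B) → O-max B }
... | inj₂ O≤I = inside ∷ I ,
  λ { (inside ∷ B) → I-max B ; (outside ∷ B) → ℕ.≤-trans (O-max B) O≤I }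

p⊆f[q]⇒∣p∣≤∣q∣ : ∀ {m l} (f : Fin m → Fin l) {p : Subset l} {q : Subset m} →
  (∀ {i} → i ∈ p → ∃ λ z → z ∈ q × f z ≡ i) → ∣ p ∣ ≤ ∣ q ∣
p⊆f[q]⇒∣p∣≤∣q∣ {l = l} f {p} {q = []} cover = ℕ.≤-reflexive (trans (cong ∣_∣ p≡⊥) (∣⊥∣≡0 l))
  where
  p≡⊥ = Empty-unique {p = p} λ (_ , i∈p) → Fin.¬Fin0 (proj₁ (cover i∈p))
p⊆f[q]⇒∣p∣≤∣q∣ f {p} {outside ∷ q} cover = p⊆f[q]⇒∣p∣≤∣q∣ (f ∘ suc) cover′
  where
  cover′ : ∀ {i} → i ∈ p → ∃ λ z → z ∈ q × f (suc z) ≡ i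
  cover′ i∈p with cover i∈p
  ... | suc z , there z∈q , fz≡i = z , z∈q , fz≡i
p⊆f[q]⇒∣p∣≤∣q∣ f {p} {inside ∷ q} cover = begin
  ∣ p ∣                                 ≡⟨ ∣p∣≡∣p∩q∣+∣p─q∣ p ⁅ f zero ⁆ ⟩
  ∣ p ∩ ⁅ f zero ⁆ ∣ + ∣ p - f zero ∣   ≤⟨ ℕ.+-mono-≤ ∣p∩⁅f₀⁆∣≤1 (p⊆f[q]⇒∣p∣≤∣q∣ (f ∘ suc) cover′) ⟩
  1 + ∣ q ∣                             ∎
  where
  open ℕ.≤-Reasoning
  ∣p∩⁅f₀⁆∣≤1 = ℕ.≤-trans (∣p∩q∣≤∣q∣ p _) (ℕ.≤-reflexive (∣⁅x⁆∣≡1 (f zero)))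
  cover′ : ∀ {i} → i ∈ p - f zero → ∃ λ z → z ∈ q × f (suc z) ≡ i
  cover′ i∈p-f₀ with cover (p─q⊆p _ _ i∈p-f₀)
  ... | zero  , _          , refl = contradiction (x∈⁅x⁆ _) (x∈p─q⇒x∉q i∈p-f₀)
  ... | suc z , there z∈q , fz≡i = z , z∈q , fz≡i

module _ (P : FinPoset) where
  open FinPoset P
  open IsPartialOrder isPartialOrder using () renaming (refl to ≼-refl; trans to ≼-trans)

  _≺_ : Fin n → Fin n → Set
  _≺_ = ToStrict._<_ _≡_ _≼_

  -- This is join-irreducibility of z in the Dedekind–MacNeille completion of P.
  JoinIrreducible : Fin n → Set
  JoinIrreducible z = ∃ λ y → ¬ z ≼ y × (∀ w → w ≺ z → w ≼ y)

  inclRep⇒decidable : ∀ {k} {S : Fin n → Subset k} → IsInclRep P k S → Decidable _≼_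
  inclRep⇒decidable {S = S} rep x y = map′ (from (rep x y)) (to (rep x y)) (S x ⊆? S y)

  module _ (_≼?_ : Decidable _≼_) where

    minimal-below : ∀ {Q : Fin n → Set} → U.Decidable Q → ∀ {x} → Q x →
      ∃ λ z → Q z × z ≼ x × (∀ w → Q w → w ≼ z → w ≡ z)
    minimal-below {Q} Q? = go (po-wellFounded isPartialOrder _)
      where
      go : ∀ {x} → Acc _≺_ x → Q x → ∃ λ z → Q z × z ≼ x × (∀ w → Q w → w ≼ z → w ≡ z)
      go {x} (acc below) Qx with Fin.any? (λ w → Q? w ×-dec ((w ≼? x) ×-dec ¬? (w Fin.≟ x)))
      ... | yes (w , Qw , w≺x) =
        let z , Qz , z≼w , z-min = go (below w≺x) Qw in z , Qz , ≼-trans z≼w (proj₁ w≺x) , z-min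
      ... | no ∄w≺x = x , Qx , ≼-refl ,
        λ w Qw w≼x → decidable-stable (w Fin.≟ x) (λ w≢x → ∄w≺x (w , Qw , w≼x , w≢x))

    -- A minimal z ≼ x with z ⋠ y is join-irreducible, witnessed by y.
    joinIrreducible-separator : ∀ {x y} → ¬ x ≼ y → ∃ λ z → z ≼ x × ¬ z ≼ y × JoinIrreducible z
    joinIrreducible-separator {x} {y} x⋠y with minimal-below (λ w → ¬? (w ≼? y)) x⋠y
    ... | z , z⋠y , z≼x , z-min = z , z≼x , z⋠y , y , z⋠y ,
      λ w (w≼z , w≢z) → decidable-stable (w ≼? y) (λ w⋠y → w≢z (z-min w w⋠y w≼z))

module Replacement (P : FinPoset) {k} {S : Fin (FinPoset.n P) → Subset k} (rep : IsInclRep P k S)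
  (N : Subset (FinPoset.n P)) (JI⊆N : ∀ {z} → JoinIrreducible P z → z ∈ N) where
  open FinPoset P
  open IsPartialOrder isPartialOrder using () renaming (trans to ≼-trans)

  private
    _≼?_ : Decidable _≼_
    _≼?_ = inclRep⇒decidable P rep

  ↓_ : Fin n → Subset n
  ↓ x = toSubset (_≼? x)

  ∈-↓⁺ : ∀ {z x} → z ≼ x → z ∈ ↓ x
  ∈-↓⁺ {x = x} = ∈-toSubset⁺ (_≼? x)

  ∈-↓⁻ : ∀ {z x} → z ∈ ↓ x → z ≼ x
  ∈-↓⁻ {x = x} = ∈-toSubset⁻ (_≼? x)

  meets : Subset k → Subset n
  meets B = toSubset (λ z → (z ∈? N) ×-dec nonempty? (S z ∩ B))

  ∈-meets⁺ : ∀ {B z a} → z ∈ N → a ∈ S z → a ∈ B → z ∈ meets B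
  ∈-meets⁺ {B} z∈N a∈Sz a∈B =
    ∈-toSubset⁺ (λ z → (z ∈? N) ×-dec nonempty? (S z ∩ B)) (z∈N , _ , x∈p∩q⁺ (a∈Sz , a∈B))

  ∈-meets⁻ : ∀ {B z} → z ∈ meets B → z ∈ N × ∃ λ a → a ∈ S z × a ∈ B
  ∈-meets⁻ {B} z∈ with ∈-toSubset⁻ (λ z → (z ∈? N) ×-dec nonempty? (S z ∩ B)) z∈
  ... | z∈N , a , a∈Sz∩B = z∈N , a , x∈p∩q⁻ _ _ a∈Sz∩B

  meets⊆N : ∀ {B} → meets B ⊆ N
  meets⊆N = proj₁ ∘ ∈-meets⁻

  meets-mono : ∀ {B₁ B₂} → B₁ ⊆ B₂ → meets B₁ ⊆ meets B₂
  meets-mono B₁⊆B₂ z∈ with ∈-meets⁻ z∈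
  ... | z∈N , a , a∈Sz , a∈B₁ = ∈-meets⁺ z∈N a∈Sz (B₁⊆B₂ a∈B₁)

  -- ∣ B ∣ − ∣ meets B ∣, shifted by n to stay in ℕ.
  surplus : Subset k → ℕ
  surplus B = ∣ B ∣ + ∣ ∁ (meets B) ∣

  surplus-exchange : ∀ {B₁ B₂} → B₁ ⊆ B₂ →
    surplus B₂ + ∣ meets B₂ ─ meets B₁ ∣ ≡ surplus B₁ + ∣ B₂ ─ B₁ ∣
  surplus-exchange {B₁} {B₂} B₁⊆B₂ = begin
    (∣ B₂ ∣ + ∣ ∁ m₂ ∣) + ∣ m₂ ─ m₁ ∣      ≡⟨ ℕ.+-assoc ∣ B₂ ∣ _ _ ⟩
    ∣ B₂ ∣ + (∣ ∁ m₂ ∣ + ∣ m₂ ─ m₁ ∣)      ≡⟨ cong (∣ B₂ ∣ +_) ∣∁m₁∣≡∣∁m₂∣+∣m₂─m₁∣ ⟨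
    ∣ B₂ ∣ + ∣ ∁ m₁ ∣                      ≡⟨ cong (_+ ∣ ∁ m₁ ∣) (p⊆q⇒∣q∣≡∣p∣+∣q─p∣ B₁⊆B₂) ⟩
    (∣ B₁ ∣ + ∣ B₂ ─ B₁ ∣) + ∣ ∁ m₁ ∣      ≡⟨ xy∙z≈xz∙y ∣ B₁ ∣ _ _ ⟩
    (∣ B₁ ∣ + ∣ ∁ m₁ ∣) + ∣ B₂ ─ B₁ ∣      ∎
    where
    open ≡-Reasoning
    m₁ = meets B₁
    m₂ = meets B₂
    ∣∁m₁∣≡∣∁m₂∣+∣m₂─m₁∣ : ∣ ∁ m₁ ∣ ≡ ∣ ∁ m₂ ∣ + ∣ m₂ ─ m₁ ∣
    ∣∁m₁∣≡∣∁m₂∣+∣m₂─m₁∣ = trans (p⊆q⇒∣q∣≡∣p∣+∣q─p∣ (p⊆q⇒∁p⊇∁q (meets-mono B₁⊆B₂)))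
                               (cong (λ r → ∣ ∁ m₂ ∣ + ∣ r ∣) (∁p─∁q≡q─p m₁ m₂))

  surplus-exchange-≤ : ∀ {B₁ B₂} → B₁ ⊆ B₂ → surplus B₁ ≤ surplus B₂ →
    ∣ meets B₂ ─ meets B₁ ∣ ≤ ∣ B₂ ─ B₁ ∣
  surplus-exchange-≤ {B₁} {B₂} B₁⊆B₂ B₁≤B₂ = ℕ.+-cancelˡ-≤ (surplus B₂) _ _ (begin
    surplus B₂ + ∣ meets B₂ ─ meets B₁ ∣   ≡⟨ surplus-exchange B₁⊆B₂ ⟩
    surplus B₁ + ∣ B₂ ─ B₁ ∣               ≤⟨ ℕ.+-monoˡ-≤ _ B₁≤B₂ ⟩
    surplus B₂ + ∣ B₂ ─ B₁ ∣               ∎)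
    where open ℕ.≤-Reasoning

  surplus-exchange-≥ : ∀ {B₁ B₂} → B₁ ⊆ B₂ → surplus B₂ ≤ surplus B₁ →
    ∣ B₂ ─ B₁ ∣ ≤ ∣ meets B₂ ─ meets B₁ ∣
  surplus-exchange-≥ {B₁} {B₂} B₁⊆B₂ B₂≤B₁ = ℕ.+-cancelˡ-≤ (surplus B₁) _ _ (begin
    surplus B₁ + ∣ B₂ ─ B₁ ∣               ≡⟨ surplus-exchange B₁⊆B₂ ⟨
    surplus B₂ + ∣ meets B₂ ─ meets B₁ ∣   ≤⟨ ℕ.+-monoˡ-≤ _ B₂≤B₁ ⟩
    surplus B₁ + ∣ meets B₂ ─ meets B₁ ∣   ∎)
    where open ℕ.≤-Reasoning

  -- The points of B are traded for one new point per z ∈ meets B, lying in S′ B x iff z ≼ x.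
  S′ : Subset k → Fin n → Subset (k + n)
  S′ B x = (S x ─ B) ++ (meets B ∩ ↓ x)

  S′-isInclRep : ∀ B → IsInclRep P (k + n) (S′ B)
  S′-isInclRep B x y = mk⇔ monotone (λ S′x⊆S′y → decidable-stable (x ≼? y) (separated S′x⊆S′y))
    where
    monotone : x ≼ y → S′ B x ⊆ S′ B y
    monotone x≼y = ++-mono-⊆ (─-monoˡ-⊆ B (to (rep x y) x≼y)) λ z∈ →
      let z∈meets , z∈↓x = x∈p∩q⁻ _ _ z∈ in
      x∈p∩q⁺ (z∈meets , ∈-↓⁺ (≼-trans (∈-↓⁻ z∈↓x) x≼y))
    -- A point a ∈ S z ∖ S y separates x from y in S′ B: a itself if a ∉ B, else the point of z.
    separated : S′ B x ⊆ S′ B y → ¬ ¬ x ≼ y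
    separated S′x⊆S′y x⋠y with joinIrreducible-separator P _≼?_ x⋠y
    ... | z , z≼x , z⋠y , z-ji with p⊈q⇒∃x∈p∖q (z⋠y ∘ from (rep z y))
    ... | a , a∈Sz , a∉Sy with a ∈? B
    ... | no a∉B = a∉Sy (p─q⊆p _ _ (∈-++⁻ˡ (S y ─ B) (S′x⊆S′y
                    (∈-++⁺ˡ _ (x∈p∧x∉q⇒x∈p─q (to (rep z x) z≼x a∈Sz) a∉B)))))
    ... | yes a∈B = z⋠y (∈-↓⁻ (proj₂ (x∈p∩q⁻ _ _ (∈-++⁻ʳ (S y ─ B) (S′x⊆S′y
                    (∈-++⁺ʳ (S x ─ B) (x∈p∩q⁺ (∈-meets⁺ (JI⊆N z-ji) a∈Sz a∈B , ∈-↓⁺ z≼x))))))))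

  module _ {B} (B-max : ∀ B′ → surplus B′ ≤ surplus B) where

    S′-size : ∀ x → ∣ S′ B x ∣ ≤ ∣ S x ∣
    S′-size x = begin
      ∣ S′ B x ∣                             ≡⟨ ∣p++q∣≡∣p∣+∣q∣ (S x ─ B) _ ⟩
      ∣ S x ─ B ∣ + ∣ meets B ∩ ↓ x ∣        ≤⟨ ℕ.+-monoʳ-≤ _ (p⊆q⇒∣p∣≤∣q∣ meets-below-x) ⟩
      ∣ S x ─ B ∣ + ∣ meets B ─ meets B₁ ∣   ≤⟨ ℕ.+-monoʳ-≤ _ (surplus-exchange-≤ B₁⊆B (B-max B₁)) ⟩
      ∣ S x ─ B ∣ + ∣ B ─ B₁ ∣               ≤⟨ ℕ.+-monoʳ-≤ _ (p⊆q⇒∣p∣≤∣q∣ B─B₁⊆Sx─[Sx─B]) ⟩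
      ∣ S x ─ B ∣ + ∣ S x ─ (S x ─ B) ∣      ≡⟨ p⊆q⇒∣q∣≡∣p∣+∣q─p∣ (p─q⊆p (S x) B) ⟨
      ∣ S x ∣                                ∎
      where
      open ℕ.≤-Reasoning
      B₁ = B ─ S x
      B₁⊆B : B₁ ⊆ B
      B₁⊆B = p─q⊆p B (S x)
      meets-below-x : meets B ∩ ↓ x ⊆ meets B ─ meets B₁
      meets-below-x {z} z∈ with x∈p∩q⁻ _ _ z∈
      ... | z∈meets , z∈↓x = x∈p∧x∉q⇒x∈p─q z∈meets λ z∈meets₁ →
        let _ , a , a∈Sz , a∈B₁ = ∈-meets⁻ z∈meets₁
        in x∈p─q⇒x∉q a∈B₁ (to (rep z x) (∈-↓⁻ z∈↓x) a∈Sz)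
      B─B₁⊆Sx─[Sx─B] : B ─ B₁ ⊆ S x ─ (S x ─ B)
      B─B₁⊆Sx─[Sx─B] {a} a∈ = x∈p∧x∉q⇒x∈p─q a∈Sx (λ a∈Sx─B → x∈p─q⇒x∉q a∈Sx─B a∈B)
        where
        a∈B = p─q⊆p _ _ a∈
        a∈Sx = decidable-stable (a ∈? S x) λ a∉Sx → x∈p─q⇒x∉q a∈ (x∈p∧x∉q⇒x∈p─q a∈B a∉Sx)

    S′-groundSize : groundSize P (S′ B) ≤ ∣ N ∣
    S′-groundSize = begin
      groundSize P (S′ B)                     ≤⟨ p⊆q⇒∣p∣≤∣q∣ ⋃S′⊆ ⟩
      ∣ (X ─ B) ++ meets B ∣                  ≡⟨ ∣p++q∣≡∣p∣+∣q∣ (X ─ B) _ ⟩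
      ∣ X ─ B ∣ + ∣ meets B ∣                 ≤⟨ ℕ.+-monoˡ-≤ _ (p⊆q⇒∣p∣≤∣q∣ X─B⊆B₂─B) ⟩
      ∣ B₂ ─ B ∣ + ∣ meets B ∣                ≤⟨ ℕ.+-monoˡ-≤ _ (surplus-exchange-≥ B⊆B₂ (B-max B₂)) ⟩
      ∣ meets B₂ ─ meets B ∣ + ∣ meets B ∣    ≡⟨ ℕ.+-comm _ ∣ meets B ∣ ⟩
      ∣ meets B ∣ + ∣ meets B₂ ─ meets B ∣    ≡⟨ p⊆q⇒∣q∣≡∣p∣+∣q─p∣ (meets-mono B⊆B₂) ⟨
      ∣ meets B₂ ∣                            ≤⟨ p⊆q⇒∣p∣≤∣q∣ meets⊆N ⟩
      ∣ N ∣                                   ∎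
      where
      open ℕ.≤-Reasoning
      X = ⋃ (List.tabulate S)
      B₂ = B ∪ X
      B⊆B₂ : B ⊆ B₂
      B⊆B₂ = p⊆p∪q X
      X─B⊆B₂─B : X ─ B ⊆ B₂ ─ B
      X─B⊆B₂─B = ─-monoˡ-⊆ B (q⊆p∪q B X)
      ⋃S′⊆ : ⋃ (List.tabulate (S′ B)) ⊆ (X ─ B) ++ meets B
      ⋃S′⊆ = ⋃-tabulate-least λ x → ++-mono-⊆ (─-monoˡ-⊆ B (⊆-⋃-tabulate S x)) (p∩q⊆p _ _)

irreducible⇒groundSize≤ : ∀ P {k} {S : Fin (FinPoset.n P) → Subset k} → IsIrreducible P k S →
  (N : Subset (FinPoset.n P)) → (∀ {z} → JoinIrreducible P z → z ∈ N) → groundSize P S ≤ ∣ N ∣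
irreducible⇒groundSize≤ P {k} {S} (rep , irreducible) N JI⊆N = ℕ.≮⇒≥ λ ∣N∣<ground →
  irreducible (k + n) (S′ B) (S′-isInclRep B)
    ( (ℕ.≤-trans (S′-groundSize B-max) (ℕ.<⇒≤ ∣N∣<ground) , S′-size B-max)
    , λ (ground≤ , _) → ℕ.<⇒≱ ∣N∣<ground (ℕ.≤-trans ground≤ (S′-groundSize B-max)))
  where
  open FinPoset P using (n)
  open Replacement P rep N JI⊆N
  B-maximiser = ∃-maximiser surplus
  B = proj₁ B-maximiser
  B-max = proj₂ B-maximiser

pinch-suc : ∀ {m} (j : Fin m) → pinch j (suc j) ≡ j
pinch-suc zero    = refl
pinch-suc (suc j) = cong suc (pinch-suc j)

pinch≡⇒ : ∀ {m} (j : Fin m) {a} → pinch j a ≡ j → a ≡ inject₁ j ⊎ a ≡ suc j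
pinch≡⇒ zero    {zero}  _  = inj₁ refl
pinch≡⇒ zero    {suc a} eq = inj₂ (cong suc eq)
pinch≡⇒ (suc j) {suc a} eq with pinch≡⇒ j (Fin.suc-injective eq)
... | inj₁ refl = inj₁ refl
... | inj₂ refl = inj₂ refl

pinch-fiber : ∀ {m} (j : Fin m) {i} → i ≢ j → ∃ λ a₀ → ∀ a → (pinch j a ≡ i) ⇔ (a ≡ a₀)
pinch-fiber j {i} i≢j = a₀ , λ a → mk⇔
  (λ ja≡i → Fin.pinch-injective (1+j≢ ja≡i) (1+j≢ ja₀≡i) (trans ja≡i (sym ja₀≡i)))
  (λ { refl → ja₀≡i })
  where
  a₀ = proj₁ (Fin.pinch-surjective j i)
  ja₀≡i : pinch j a₀ ≡ i
  ja₀≡i = proj₂ (Fin.pinch-surjective j i) refl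
  1+j≢ : ∀ {a} → pinch j a ≡ i → suc j ≢ a
  1+j≢ ja≡i refl = i≢j (trans (sym ja≡i) (pinch-suc j))

adjacent⇒consecutive : ∀ {m} {a b : Fin (suc m)} → toℕ b ≡ suc (toℕ a) →
  ∃ λ j → a ≡ inject₁ j × b ≡ suc j
adjacent⇒consecutive {suc m} {zero}  {suc zero} _ = zero , refl , refl
adjacent⇒consecutive {suc m} {suc a} {suc b} b≡1+a with adjacent⇒consecutive (ℕ.suc-injective b≡1+a)
... | j , refl , refl = suc j , refl , refl

module _ (P : FinPoset) where
  open FinPoset P
  open IsPartialOrder isPartialOrder using (antisym)

  module _ {U : Fin n → Set} {t} {p : Fin n → Fin t} (sum : IsVerticalSumOn P U t p)
           {x y} (Ux : U x) (Uy : U y) where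

    <-level⇒≼ : p x <ᶠ p y → x ≼ y
    <-level⇒≼ px<py = from (proj₂ sum x y Ux Uy) (inj₂ px<py)

    ≼⇒≤-level : x ≼ y → p x ≤ᶠ p y
    ≼⇒≤-level x≼y with to (proj₂ sum x y Ux Uy) x≼y
    ... | inj₁ (px≡py , _) = ℕ.≤-reflexive (cong toℕ px≡py)
    ... | inj₂ px<py       = ℕ.<⇒≤ px<py

  isVerticalSumOn-∘ : ∀ {U t t′ p} (g : Fin t → Fin t′) → Surjective _≡_ _≡_ g →
    (∀ {a b} → a ≤ᶠ b → g a ≤ᶠ g b) → IsVerticalSumOn P U t p → IsVerticalSumOn P U t′ (g ∘ p)
  isVerticalSumOn-∘ {p = p} g g-onto g-mono sum@(onto , _) = onto′ , order′
    where
    onto′ : ∀ i → _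
    onto′ i with g-onto i
    ... | a , ga≡i with onto a
    ... | x , Ux , px≡a = x , Ux , ga≡i px≡a
    order′ : ∀ x y → _
    order′ x y Ux Uy = mk⇔ ≼⇒ ⇒≼
      where
      ≼⇒ : x ≼ y → (g (p x) ≡ g (p y) × x ≼ y) ⊎ (g (p x) <ᶠ g (p y))
      ≼⇒ x≼y with ℕ.m≤n⇒m<n∨m≡n (g-mono (≼⇒≤-level sum Ux Uy x≼y))
      ... | inj₁ gpx<gpy = inj₂ gpx<gpy
      ... | inj₂ gpx≡gpy = inj₁ (Fin.toℕ-injective gpx≡gpy , x≼y)
      ⇒≼ : (g (p x) ≡ g (p y) × x ≼ y) ⊎ (g (p x) <ᶠ g (p y)) → x ≼ y
      ⇒≼ (inj₁ (_ , x≼y)) = x≼y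
      ⇒≼ (inj₂ gpx<gpy)   = <-level⇒≼ sum Ux Uy (ℕ.≰⇒> λ py≤px → ℕ.<⇒≱ gpx<gpy (g-mono py≤px))

  isBlockOn-resp : ∀ {U V : Fin n → Set} → (∀ x → U x ⇔ V x) → IsBlockOn P U → IsBlockOn P V
  isBlockOn-resp U⇔V (inj₁ chain) = inj₁ λ x y Vx Vy → chain x y (from (U⇔V x) Vx) (from (U⇔V y) Vy)
  isBlockOn-resp U⇔V (inj₂ ¬sum) = inj₂ λ (q , onto , order) → ¬sum
    ( q
    , (λ i → let x , Vx , qx≡i = onto i in x , from (U⇔V x) Vx , qx≡i)
    , (λ x y Ux Uy → order x y (to (U⇔V x) Ux) (to (U⇔V y) Uy)))

  top : Fin n → Fin n → Fin 2
  top y x with x Fin.≟ y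
  ... | yes _ = suc zero
  ... | no _  = zero

  top-≢ : ∀ {y x} → x ≢ y → top y x ≡ zero
  top-≢ {y} {x} x≢y with x Fin.≟ y
  ... | yes x≡y = contradiction x≡y x≢y
  ... | no _    = refl

  top-≡ : ∀ y → top y y ≡ suc zero
  top-≡ y with y Fin.≟ y
  ... | yes _  = refl
  ... | no y≢y = contradiction refl y≢y

  isVerticalSumOn-top : ∀ {U a y} → U a → a ≢ y → U y → (∀ w → U w → w ≼ y) →
    IsVerticalSumOn P U 2 (top y)
  isVerticalSumOn-top {U} {a} {y} Ua a≢y Uy y-max = onto , order
    where
    onto : ∀ i → ∃ λ x → U x × top y x ≡ i
    onto zero       = a , Ua , top-≢ a≢y
    onto (suc zero) = y , Uy , top-≡ y
    order : ∀ b c → U b → U c → (b ≼ c) ⇔ ((top y b ≡ top y c × b ≼ c) ⊎ (top y b <ᶠ top y c))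
    order b c Ub Uc with b Fin.≟ y | c Fin.≟ y
    ... | yes _    | yes _    = mk⇔ (λ b≼c → inj₁ (refl , b≼c))
                                    λ { (inj₁ (_ , b≼c)) → b≼c ; (inj₂ (s≤s ())) }
    ... | yes refl | no c≢y   = mk⇔ (λ y≼c → contradiction (antisym (y-max c Uc) y≼c) c≢y)
                                    λ { (inj₁ (() , _)) ; (inj₂ ()) }
    ... | no _     | yes refl = mk⇔ (λ _ → inj₂ (s≤s z≤n)) (λ _ → y-max b Ub)
    ... | no _     | no _     = mk⇔ (λ b≼c → inj₁ (refl , b≼c))
                                    λ { (inj₁ (_ , b≼c)) → b≼c ; (inj₂ ()) }

  block-with-greatest-isChain : ∀ {U y} → IsBlockOn P U → U y → (∀ w → U w → w ≼ y) → IsChainOn P U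
  block-with-greatest-isChain (inj₁ chain) _ _ = chain
  block-with-greatest-isChain {y = y} (inj₂ ¬sum) Uy y-max a b Ua Ub with a Fin.≟ y | b Fin.≟ y
  ... | yes refl | _        = inj₂ (y-max b Ub)
  ... | no _     | yes refl = inj₁ (y-max a Ua)
  ... | no a≢y   | no _     = contradiction (top y , isVerticalSumOn-top Ua a≢y Uy y-max) ¬sum

  merge-chain-blocks : ∀ {t₀ p} (j : Fin t₀) → IsDecompIntoBlocks P (suc t₀) p →
    IsChainOn P (λ x → p x ≡ inject₁ j) → IsChainOn P (λ x → p x ≡ suc j) →
    IsDecompIntoBlocks P t₀ (pinch j ∘ p) × IsChainOn P (λ x → pinch j (p x) ≡ j)
  merge-chain-blocks {p = p} j (sum , blocks) chainˡ chainʳ = (sum′ , blocks′) , merged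
    where
    sum′ = isVerticalSumOn-∘ (pinch j) (Fin.pinch-surjective j) (Fin.pinch-mono-≤ j) sum
    merged : IsChainOn P (λ x → pinch j (p x) ≡ j)
    merged a b ja≡j _ with Fin.<-cmp (p a) (p b)
    ... | tri< pa<pb _ _ = inj₁ (<-level⇒≼ sum tt tt pa<pb)
    ... | tri> _ _ pb<pa = inj₂ (<-level⇒≼ sum tt tt pb<pa)
    ... | tri≈ _ pa≡pb _ with pinch≡⇒ j ja≡j
    ...   | inj₁ pa≡j   = chainˡ a b pa≡j (trans (sym pa≡pb) pa≡j)
    ...   | inj₂ pa≡1+j = chainʳ a b pa≡1+j (trans (sym pa≡pb) pa≡1+j)
    blocks′ : ∀ i → IsBlockOn P (λ x → pinch j (p x) ≡ i)
    blocks′ i with i Fin.≟ j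
    ... | yes refl = inj₁ merged
    ... | no i≢j   = let a₀ , fiber = pinch-fiber j i≢j in
      isBlockOn-resp (λ x → ⇔.sym (fiber (p x))) (blocks a₀)

  no-consecutive-chain-blocks : ∀ {t₀ p} (j : Fin t₀) → IsBlockDecomposition P (suc t₀) p →
    IsChainOn P (λ x → p x ≡ inject₁ j) → IsChainOn P (λ x → p x ≡ suc j) → ⊥
  no-consecutive-chain-blocks {suc _} _ (_ , inj₁ (_ , ()))
  no-consecutive-chain-blocks {1} zero (decomp , inj₂ (¬block , _)) chainˡ chainʳ =
    ¬block (inj₁ λ a b _ _ → merged a b (Fin1-unique _) (Fin1-unique _))
    where
    merged = proj₂ (merge-chain-blocks zero decomp chainˡ chainʳ)
    Fin1-unique : ∀ (i : Fin 1) → i ≡ zero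
    Fin1-unique zero = refl
  no-consecutive-chain-blocks {suc (suc _)} j (decomp , inj₂ (_ , _ , least)) chainˡ chainʳ =
    ℕ.<-irrefl refl (least _ _ (s≤s (s≤s z≤n)) (proj₁ (merge-chain-blocks j decomp chainˡ chainʳ)))

  no-adjacent-chain-blocks : ∀ {t p} → IsBlockDecomposition P t p → ∀ {a b : Fin t} →
    toℕ b ≡ suc (toℕ a) → IsChainOn P (λ x → p x ≡ a) → IsChainOn P (λ x → p x ≡ b) → ⊥
  no-adjacent-chain-blocks {suc _} bd b≡1+a chainᵃ chainᵇ with adjacent⇒consecutive b≡1+a
  ... | j , refl , refl = no-consecutive-chain-blocks j bd chainᵃ chainᵇ

  level-gap : ∀ {t p} → IsVerticalSumOn P (λ _ → ⊤) t p → ∀ {y z} →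
    (∀ w → p w <ᶠ p z → w ≼ y) → toℕ (p z) ≤ suc (toℕ (p y))
  level-gap {p = p} sum@(onto , _) {y} {z} y-bounds = ℕ.≮⇒≥ λ 1+py<pz →
    let c<t = ℕ.<-trans 1+py<pz (Fin.toℕ<n (p z))
        w , _ , pw≡c = onto (fromℕ< c<t)
        pw≡1+py = trans (cong toℕ pw≡c) (Fin.toℕ-fromℕ< c<t)
        pw<pz = subst (_< toℕ (p z)) (sym pw≡1+py) 1+py<pz
    in ℕ.<-irrefl refl (subst (_≤ toℕ (p y)) pw≡1+py (≼⇒≤-level sum tt tt (y-bounds w pw<pz)))

  least-of-chain-block-not-joinIrreducible : ∀ {t p} → IsBlockDecomposition P t p → ∀ {z} →
    IsChainOn P (λ x → p x ≡ p z) → (∀ w → p w ≡ p z → z ≼ w) → ¬ JoinIrreducible P z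
  least-of-chain-block-not-joinIrreducible {p = p} bd@((sum , blocks) , _) {z} chain z-least
    (y , z⋠y , y-bounds)
    with Fin.<-cmp (p z) (p y)
  ... | tri< pz<py _ _ = z⋠y (<-level⇒≼ sum tt tt pz<py)
  ... | tri≈ _ pz≡py _ = z⋠y (z-least y (sym pz≡py))
  ... | tri> _ _ py<pz = no-adjacent-chain-blocks bd adjacent chain-py chain
    where
    -- y is then the greatest element of the block directly below that of z.
    below-z : ∀ w → p w <ᶠ p z → w ≼ y
    below-z w pw<pz = y-bounds w (<-level⇒≼ sum tt tt pw<pz , λ { refl → Fin.<-irrefl refl pw<pz })
    adjacent : toℕ (p z) ≡ suc (toℕ (p y))
    adjacent = ℕ.≤-antisym (level-gap sum below-z) py<pz
    chain-py : IsChainOn P (λ x → p x ≡ p y)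
    chain-py = block-with-greatest-isChain (blocks (p y)) refl
      λ w pw≡py → below-z w (subst (_<ᶠ p z) (sym pw≡py) py<pz)

module LeastOfChainBlocks (P : FinPoset) (_≼?_ : Decidable (FinPoset._≼_ P))
  {t} {p : Fin (FinPoset.n P) → Fin t} (bd : IsBlockDecomposition P t p)
  {C : Subset t} (C-chains : ∀ {i} → i ∈ C → IsChainOn P (λ x → p x ≡ i)) where
  open FinPoset P
  open IsPartialOrder isPartialOrder using () renaming (reflexive to ≼-reflexive)

  IsLeastOfChainBlock : Fin n → Set
  IsLeastOfChainBlock z = p z ∈ C × (∀ w → p w ≡ p z → z ≼ w)

  least? : U.Decidable IsLeastOfChainBlock
  least? z = (p z ∈? C) ×-dec Fin.all? (λ w → (p w Fin.≟ p z) →-dec (z ≼? w))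

  leastOfChainBlocks : Subset n
  leastOfChainBlocks = toSubset least?

  ∈-leastOfChainBlocks⇒¬JI : ∀ {z} → z ∈ leastOfChainBlocks → ¬ JoinIrreducible P z
  ∈-leastOfChainBlocks⇒¬JI z∈ with ∈-toSubset⁻ least? z∈
  ... | pz∈C , z-least = least-of-chain-block-not-joinIrreducible P bd (C-chains pz∈C) z-least

  chain-block-has-least : ∀ {i} → i ∈ C → ∃ λ z → p z ≡ i × IsLeastOfChainBlock z
  chain-block-has-least {i} i∈C with proj₁ (proj₁ (proj₁ bd)) i
  ... | x , _ , px≡i with minimal-below P _≼?_ (λ w → p w Fin.≟ i) px≡i
  ... | z , refl , _ , z-min = z , refl , i∈C , z-least
    where
    z-least : ∀ w → p w ≡ p z → z ≼ w
    z-least w pw≡pz with C-chains i∈C z w refl pw≡pz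
    ... | inj₁ z≼w = z≼w
    ... | inj₂ w≼z = ≼-reflexive (sym (z-min w pw≡pz w≼z))

  ∣C∣≤∣leastOfChainBlocks∣ : ∣ C ∣ ≤ ∣ leastOfChainBlocks ∣
  ∣C∣≤∣leastOfChainBlocks∣ = p⊆f[q]⇒∣p∣≤∣q∣ p λ i∈C →
    let z , pz≡i , z-least = chain-block-has-least i∈C in z , ∈-toSubset⁺ least? z-least , pz≡i

corollary3p4 : (P : FinPoset) (t : ℕ) (p : Fin (FinPoset.n P) → Fin t) →
    IsBlockDecomposition P t p →
    (C : Subset t) → (∀ i → (i ∈ C) ⇔ IsChainOn P (λ x → p x ≡ i)) →
    iir≤ P (FinPoset.n P ∸ ∣ C ∣)
corollary3p4 P t p bd C C⇔chain k S irr = begin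
  groundSize P S              ≤⟨ irreducible⇒groundSize≤ P irr (∁ M) JI⊆∁M ⟩
  ∣ ∁ M ∣                     ≡⟨ ∣∁p∣≡n∸∣p∣ M ⟩
  n ∸ ∣ M ∣                   ≤⟨ ℕ.∸-monoʳ-≤ n ∣C∣≤∣leastOfChainBlocks∣ ⟩
  n ∸ ∣ C ∣                   ∎
  where
  open FinPoset P using (n)
  open ℕ.≤-Reasoning
  open LeastOfChainBlocks P (inclRep⇒decidable P (proj₁ irr)) bd (to (C⇔chain _))
  M = leastOfChainBlocks
  JI⊆∁M : ∀ {z} → JoinIrreducible P z → z ∈ ∁ M
  JI⊆∁M z-ji = x∉p⇒x∈∁p λ z∈M → ∈-leastOfChainBlocks⇒¬JI z∈M z-ji
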